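{- Let $G$ be a graph with vertex set $V$, maximum degree $\Delta=\Delta(G)$ and minimum degree $\delta(G)$. (1) If $e\Delta^2\leq 2^{\delta(G)-1}$ and there is a total dominating set $T\subsetneq V$, then $\chi_d(G)\leq \chi(G[V\setminus T])+2\chi(G[T])$. (2) If $G$ has a double total dominating set $T\subseteq V$, then $\chi_d(G)\leq \chi(G[V\setminus T])+\chi(G[T])$.
   Context: All graphs are finite and simple; $e$ is Euler's number; $G[S]$ is the subgraph induced by $S$. A set $T\subseteq V(G)$ is a total dominating set if every vertex of $G$ has at least one neighbor in $T$; $T$ is a double total dominating set if both $T$ and $V(G)\setminus T$ are total dominating sets. A dynamic coloring of $G$ is a proper vertex coloring such that every vertex of degree at least $2$ has neighbors of at least two different colors; $\chi_d(G)$ is the smallest number of colors in a dynamic coloring, and $\chi$ denotes the chromatic number. -}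

module Defs where

open import Data.Nat using (ℕ; zero; suc; _+_; _*_; _^_; _≤_; _⊔_; _⊓_)
open import Data.Nat using (_!)
open import Data.Nat.ListAction using (sum)
open import Data.Bool using (Bool; true; false; T; if_then_else_)
open import Data.Fin using (Fin)
open import Data.Fin.Subset using (Subset; _∈_; _∉_; ∁) public
open import Data.List using (List; map; foldr; allFin)
open import Data.Product using (Σ; ∃; ∃-syntax; _×_)
open import Relation.Binary.PropositionalEquality using (_≡_; _≢_)

record Graph (n : ℕ) : Set where
  field
    adj    : Fin n → Fin n → Bool
    sym    : ∀ u v → adj u v ≡ adj v u
    irrefl : ∀ v → adj v v ≡ false
open Graph public

Adj : ∀ {n} → Graph n → Fin n → Fin n → Set
Adj G u v = T (adj G u v)

deg : ∀ {n} → Graph n → Fin n → ℕ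
deg {n} G v = sum (map (λ u → if adj G v u then 1 else 0) (allFin n))

maxDeg : ∀ {n} → Graph n → ℕ
maxDeg {n} G = foldr _⊔_ 0 (map (deg G) (allFin n))

-- minimum degree δ(G); every degree is < n, so starting the fold at n is
-- correct whenever n ≥ 1 (the value for n = 0 is an irrelevant convention)
minDeg : ∀ {n} → Graph n → ℕ
minDeg {n} G = foldr _⊓_ n (map (deg G) (allFin n))

IsTotalDominating : ∀ {n} → Graph n → Subset n → Set
IsTotalDominating G S = ∀ v → ∃[ u ] (Adj G v u × u ∈ S)

IsDoubleTotalDominating : ∀ {n} → Graph n → Subset n → Set
IsDoubleTotalDominating G S = IsTotalDominating G S × IsTotalDominating G (∁ S)

ProperColouringOn : ∀ {n} → Graph n → Subset n → ℕ → Set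
ProperColouringOn {n} G S k =
  Σ ((v : Fin n) → v ∈ S → Fin k) λ c →
    ∀ u v (pu : u ∈ S) (pv : v ∈ S) → Adj G u v → c u pu ≢ c v pv

IsChromaticNumberOn : ∀ {n} → Graph n → Subset n → ℕ → Set
IsChromaticNumberOn G S k =
  ProperColouringOn G S k × (∀ j → ProperColouringOn G S j → k ≤ j)

DynamicColouring : ∀ {n} → Graph n → ℕ → Set
DynamicColouring {n} G k =
  Σ (Fin n → Fin k) λ c →
    (∀ u v → Adj G u v → c u ≢ c v) ×
    (∀ v → 2 ≤ deg G v → ∃[ u ] ∃[ w ] (Adj G v u × Adj G v w × c u ≢ c w))

IsDynamicChromaticNumber : ∀ {n} → Graph n → ℕ → Set
IsDynamicChromaticNumber G k =
  DynamicColouring G k × (∀ j → DynamicColouring G j → k ≤ j)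

-- eFact m = m! * Σ_{k=0}^{m} 1/k!   (an integer: Σ_{k≤m} m!/k!)
eFact : ℕ → ℕ
eFact zero    = 1
eFact (suc m) = suc m * eFact m + 1

-- e * Δ² ≤ 2^(δ-1), i.e. 2 e Δ² ≤ 2^δ.  Since the partial sums
-- Σ_{k≤m} 1/k! increase to e, this holds iff for every m
-- 2 Δ² Σ_{k≤m} 1/k! ≤ 2^δ, i.e. 2 Δ² eFact m ≤ 2^δ m!.
EulerBound : ℕ → ℕ → Set
EulerBound Δ δ = ∀ m → 2 * (eFact m * (Δ * Δ)) ≤ 2 ^ δ * m !

-- Colour V ∖ S and S (the paper's T) properly from disjoint palettes; edges between the two
-- sides are then proper too. Under (2) every vertex has a neighbour on each side, and these two
-- get different colours. Under (1) a vertex may have all its neighbours in S, so each colour class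
-- of S is split in two by a 2-colouring σ of V under which no neighbourhood is monochromatic. For
-- a uniformly random σ, N(v) is monochromatic with probability 2^(1 - deg v) ≤ 2^(1 - δ); the
-- event depends only on σ on N(v), so it is independent of all but at most Δ(Δ - 1) ≤ Δ² - 1 = D
-- others. The symmetric Lovász Local Lemma, in the form Pr(E) ≤ D^D / (D + 1)^(D + 1), then yields
-- σ: this condition follows from e Δ² ≤ 2^(δ - 1) because (1 + 1/D)^D ≤ Σ_{k ≤ D} 1/k!. The local
-- lemma itself is the usual induction showing Pr(E i | no event of J) ≤ 1/(D + 1) for every J ∌ i.

module Submission where

open import Defs hiding (sym)
open import Data.Nat using (ℕ; zero; suc; NonZero; >-nonZero; _!; _⊔_; _⊓_; _+_; _*_; _∸_; _^_; _≤_; _<_; z≤n; s≤s; z<s)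
open import Data.Nat.Properties hiding (_≟_)
open import Data.Nat.ListAction using (sum)
open import Data.Nat.Induction using (<-wellFounded)
open import Induction.WellFounded using (module All)
import Relation.Binary.Construct.On as On
open import Level using (0ℓ)
open import Data.Nat.Tactic.RingSolver using (solve-∀)
open import Algebra.Properties.CommutativeSemigroup +-commutativeSemigroup using () renaming (interchange to +-interchange)
open import Data.Bool using (Bool; true; false; T; not; _∧_; _∨_; _xor_; if_then_else_)
open import Data.Bool.Properties using (∧-comm; ∧-identityʳ; ∧-zeroʳ; xor-identityʳ; xor-comm; true-xor; T-∧; T-∨)
open import Function.Bundles using (Equivalence; Inverse)
open import Data.Fin using (Fin; zero; suc; join; splitAt; combine; remQuot)
open import Data.Fin.Properties using (_≟_; all?; any?; ¬∀⟶∃¬; splitAt-join; remQuot-combine; 2↔Bool)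
open import Data.Fin.Subset.Properties using (_∈?_; x∉p⇒x∈∁p; x∈∁p⇒x∉p)
open import Data.Vec.Properties.WithK using ([]=-irrelevant)
open import Data.Sum.Properties using (inj₁-injective; inj₂-injective)
open import Data.Product.Properties using (,-injective)
open import Data.List using (tabulate; foldr)
open import Data.List.Properties using (tabulate-cong; map-tabulate)
open import Data.Vec.Functional using (Vector; []; _∷_)
open import Data.Product using (_×_; _,_; proj₁; proj₂; ∃-syntax)
open import Data.Sum using (_⊎_; inj₁; inj₂)
import Data.Sum as Sum
open import Data.Empty using (⊥-elim)
open import Data.Unit using (tt)
open import Function using (_∘_; id; case_of_)
open import Relation.Nullary using (¬_; ¬?; does; yes; no; contradiction; _×-dec_)
open import Relation.Nullary.Decidable using (T?; decidable-stable; isYes≗does; toWitness; fromWitness; dec-true; dec-false)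
open import Relation.Binary.PropositionalEquality

T-not⁺ : ∀ {b} → ¬ T b → T (not b)
T-not⁺ {false} _  = tt
T-not⁺ {true}  ¬t = ¬t tt

T-not⁻ : ∀ {b} → T (not b) → ¬ T b
T-not⁻ {false} _ ()

infix 4 _⊆ᵇ_
_⊆ᵇ_ : {A : Set} → (A → Bool) → (A → Bool) → Set
P ⊆ᵇ Q = ∀ {x} → T (P x) → T (Q x)

-- Through does rather than ⌊_⌋, so that allᵇ f reduces to f zero ∧ allᵇ (f ∘ suc).
allᵇ : ∀ {m} → (Fin m → Bool) → Bool
allᵇ f = does (all? (T? ∘ f))

anyᵇ : ∀ {m} → (Fin m → Bool) → Bool
anyᵇ f = does (any? (T? ∘ f))

module _ {m} {f : Fin m → Bool} where

  allᵇ⁺ : (∀ x → T (f x)) → T (allᵇ f)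
  allᵇ⁺ h = subst T (isYes≗does (all? (T? ∘ f))) (fromWitness h)

  allᵇ⁻ : T (allᵇ f) → ∀ x → T (f x)
  allᵇ⁻ t = toWitness (subst T (sym (isYes≗does (all? (T? ∘ f)))) t)

  ¬allᵇ⇒∃ : ¬ T (allᵇ f) → ∃[ x ] ¬ T (f x)
  ¬allᵇ⇒∃ ¬t = ¬∀⟶∃¬ m (T ∘ f) (T? ∘ f) (¬t ∘ allᵇ⁺)

  anyᵇ⁺ : ∀ x → T (f x) → T (anyᵇ f)
  anyᵇ⁺ x t = subst T (isYes≗does (any? (T? ∘ f))) (fromWitness (x , t))

  anyᵇ⁻ : T (anyᵇ f) → ∃[ x ] T (f x)
  anyᵇ⁻ t = toWitness (subst T (sym (isYes≗does (any? (T? ∘ f)))) t)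

infixl 6 _-_
_-_ : ∀ {m} → (Fin m → Bool) → Fin m → Fin m → Bool
(X - j) x = X x ∧ not (does (x ≟ j))

remove-≢ : ∀ {m} (X : Fin m → Bool) {x j} → x ≢ j → (X - j) x ≡ X x
remove-≢ X {x} {j} x≢j = trans (cong (λ b → X x ∧ not b) (dec-false (x ≟ j) x≢j)) (∧-identityʳ (X x))

remove-self : ∀ {m} (X : Fin m → Bool) j → (X - j) j ≡ false
remove-self X j = trans (cong (λ b → X j ∧ not b) (dec-true (j ≟ j) refl)) (∧-zeroʳ (X j))

infixl 6 _∖_
_∖_ : ∀ {m} → (Fin m → Bool) → (Fin m → Bool) → Fin m → Bool
(J ∖ U) x = J x ∧ not (U x)

∧-swapʳ : ∀ a b c → (a ∧ b) ∧ c ≡ (a ∧ c) ∧ b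
∧-swapʳ true  b c = ∧-comm b c
∧-swapʳ false b c = refl

Disjoint : ∀ {n} → (Fin n → Bool) → (Fin n → Bool) → Set
Disjoint X Y = ∀ x → T (X x) → ¬ T (Y x)

meets : ∀ {n} → (Fin n → Bool) → (Fin n → Bool) → Bool
meets X Y = anyᵇ (λ x → X x ∧ Y x)

¬meets⇒disjoint : ∀ {n} {X Y : Fin n → Bool} → ¬ T (meets X Y) → Disjoint X Y
¬meets⇒disjoint ¬meets x x∈X x∈Y = ¬meets (anyᵇ⁺ x (Equivalence.from T-∧ (x∈X , x∈Y)))

size : ∀ {m} → (Fin m → Bool) → ℕ
size X = sum (tabulate (λ x → if X x then 1 else 0))

size-cong : ∀ {m} {X Y : Fin m → Bool} → (∀ x → X x ≡ Y x) → size X ≡ size Y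
size-cong X≗Y = cong sum (tabulate-cong (λ x → cong (λ b → if b then 1 else 0) (X≗Y x)))

size-mono : ∀ {m} {X Y : Fin m → Bool} → X ⊆ᵇ Y → size X ≤ size Y
size-mono {zero} _ = z≤n
size-mono {suc m} {X} {Y} X⊆Y with X zero | Y zero | X⊆Y {zero}
... | false | _     | _ = +-mono-≤ z≤n (size-mono (λ {x} → X⊆Y {suc x}))
... | true  | true  | _ = s≤s (size-mono (λ {x} → X⊆Y {suc x}))
... | true  | false | h = ⊥-elim (h tt)

size>0⇒∃ : ∀ {m} (X : Fin m → Bool) → 0 < size X → ∃[ x ] T (X x)
size>0⇒∃ {suc m} X pos with X zero in eq
... | true  = zero , subst T (sym eq) tt
... | false = let x , t = size>0⇒∃ (X ∘ suc) pos in suc x , t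

∈⇒size>0 : ∀ {m} (X : Fin m → Bool) x → T (X x) → 0 < size X
∈⇒size>0 X zero t with X zero
... | true = z<s
∈⇒size>0 X (suc x) t with X zero
... | true  = z<s
... | false = ∈⇒size>0 (X ∘ suc) x t

size-remove : ∀ {m} (X : Fin m → Bool) j → T (X j) → size X ≡ suc (size (X - j))
size-remove X zero t with X zero
... | true = cong suc (size-cong (λ x → sym (∧-identityʳ (X (suc x)))))
size-remove X (suc j) t with X zero
... | true  = cong suc (size-remove (X ∘ suc) j t)
... | false = size-remove (X ∘ suc) j t

size-∪ : ∀ {m} (X Y : Fin m → Bool) → size (λ x → X x ∨ Y x) ≤ size X + size Y
size-∪ {zero} X Y = z≤n
size-∪ {suc m} X Y with X zero | Y zero
... | false | false = size-∪ (X ∘ suc) (Y ∘ suc)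
... | false | true  = ≤-trans (s≤s (size-∪ (X ∘ suc) (Y ∘ suc))) (≤-reflexive (sym (+-suc _ _)))
... | true  | false = s≤s (size-∪ (X ∘ suc) (Y ∘ suc))
... | true  | true  = s≤s (≤-trans (size-∪ (X ∘ suc) (Y ∘ suc)) (≤-trans (m≤n+m _ 1) (≤-reflexive (sym (+-suc _ _)))))

size-∅ : ∀ {m} → size {m} (λ _ → false) ≡ 0
size-∅ {zero}  = refl
size-∅ {suc m} = size-∅ {m}

size-⋃ : ∀ {k m} (F : Fin k → Fin m → Bool) →
         size (λ j → anyᵇ (λ u → F u j)) ≤ sum (tabulate (λ u → size (F u)))
size-⋃ {zero}  {m} F = ≤-reflexive (size-∅ {m})
size-⋃ {suc k}     F = ≤-trans (size-∪ (F zero) _) (+-monoʳ-≤ (size (F zero)) (size-⋃ (F ∘ suc)))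

sum-indicator : ∀ {m} (X : Fin m → Bool) c → sum (tabulate (λ u → if X u then c else 0)) ≡ size X * c
sum-indicator {zero}  X c = refl
sum-indicator {suc m} X c with X zero
... | true  = cong (c +_) (sum-indicator (X ∘ suc) c)
... | false = sum-indicator (X ∘ suc) c

-- Counting assignments

Assignment : ℕ → Set
Assignment = Vector Bool

-- count P is 2 ^ n times the probability of P under a uniformly random assignment.
count : ∀ {n} → (Assignment n → Bool) → ℕ
count {zero}  P = if P [] then 1 else 0
count {suc n} P = count (P ∘ (false ∷_)) + count (P ∘ (true ∷_))

count-mono : ∀ {n} {P Q : Assignment n → Bool} → P ⊆ᵇ Q → count P ≤ count Q
count-mono {zero} {P} {Q} P⊆Q with P [] | Q [] | P⊆Q {[]}
... | false | _     | _ = z≤n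
... | true  | true  | _ = ≤-refl
... | true  | false | h = ⊥-elim (h tt)
count-mono {suc n} {P} {Q} P⊆Q =
  +-mono-≤ (count-mono {P = P ∘ (false ∷_)} {Q ∘ (false ∷_)} P⊆Q)
           (count-mono {P = P ∘ (true ∷_)} {Q ∘ (true ∷_)} P⊆Q)

count-≐ : ∀ {n} {P Q : Assignment n → Bool} → P ⊆ᵇ Q → Q ⊆ᵇ P → count P ≡ count Q
count-≐ {P = P} {Q} P⊆Q Q⊆P = ≤-antisym (count-mono {P = P} {Q} P⊆Q) (count-mono {P = Q} {P} Q⊆P)

count-split : ∀ {n} (P Q : Assignment n → Bool) →
              count P ≡ count (λ σ → P σ ∧ Q σ) + count (λ σ → P σ ∧ not (Q σ))
count-split {zero} P Q with P [] | Q []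
... | false | _     = refl
... | true  | true  = refl
... | true  | false = refl
count-split {suc n} P Q =
  trans (cong₂ _+_ (count-split (P ∘ (false ∷_)) (Q ∘ (false ∷_))) (count-split (P ∘ (true ∷_)) (Q ∘ (true ∷_))))
        (+-interchange (with-Q false) (without-Q false) (with-Q true) (without-Q true))
  where
    with-Q without-Q : Bool → ℕ
    with-Q    b = count (λ σ → P (b ∷ σ) ∧ Q (b ∷ σ))
    without-Q b = count (λ σ → P (b ∷ σ) ∧ not (Q (b ∷ σ)))

count-∨ : ∀ {n} (P Q : Assignment n → Bool) → count (λ σ → P σ ∨ Q σ) ≤ count P + count Q
count-∨ P Q = begin
  count P∨Q
    ≡⟨ count-split P∨Q P ⟩
  count (λ σ → P∨Q σ ∧ P σ) + count (λ σ → P∨Q σ ∧ not (P σ))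
    ≤⟨ +-mono-≤ (count-mono {P = λ σ → P∨Q σ ∧ P σ} left) (count-mono {P = λ σ → P∨Q σ ∧ not (P σ)} right) ⟩
  count P + count Q ∎
  where
    open ≤-Reasoning
    P∨Q : Assignment _ → Bool
    P∨Q σ = P σ ∨ Q σ
    left : (λ σ → P∨Q σ ∧ P σ) ⊆ᵇ P
    left t = proj₂ (Equivalence.to T-∧ t)
    right : (λ σ → P∨Q σ ∧ not (P σ)) ⊆ᵇ Q
    right {σ} t with P σ
    ... | false = proj₁ (Equivalence.to T-∧ t)

count-true : ∀ n → count {n} (λ _ → true) ≡ 2 ^ n
count-true zero    = refl
count-true (suc n) = cong₂ _+_ (count-true n) (trans (count-true n) (sym (+-identityʳ _)))

count-false : ∀ n → count {n} (λ _ → false) ≡ 0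
count-false zero    = refl
count-false (suc n) = cong₂ _+_ (count-false n) (count-false n)

count>0⇒∃ : ∀ {n} (P : Assignment n → Bool) → 0 < count P → ∃[ σ ] T (P σ)
count>0⇒∃ {zero} P pos with P [] in eq
... | true = [] , subst T (sym eq) tt
count>0⇒∃ {suc n} P pos with count (P ∘ (false ∷_)) in eq
... | suc _ = let σ , t = count>0⇒∃ (P ∘ (false ∷_)) (subst (0 <_) (sym eq) z<s) in false ∷ σ , t
... | zero  = let σ , t = count>0⇒∃ (P ∘ (true ∷_)) pos in true ∷ σ , t

DependsOnlyOn : ∀ {n} → (Fin n → Bool) → (Assignment n → Bool) → Set
DependsOnlyOn X P = ∀ {σ τ} → (∀ x → T (X x) → σ x ≡ τ x) → T (P σ) → T (P τ)

dependsOnlyOn-∷ : ∀ {n} {X : Fin (suc n) → Bool} {P} →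
                  DependsOnlyOn X P → ∀ b → DependsOnlyOn (X ∘ suc) (P ∘ (b ∷_))
dependsOnlyOn-∷ P-local b {σ} {τ} agree = P-local {b ∷ σ} {b ∷ τ} λ { zero _ → refl ; (suc x) t → agree x t }

count-head-irrelevant : ∀ {n} {X : Fin (suc n) → Bool} {P} → DependsOnlyOn X P → ¬ T (X zero) →
                        count (P ∘ (false ∷_)) ≡ count (P ∘ (true ∷_))
count-head-irrelevant {X = X} {P} P-local zero∉X =
  count-≐ {P = P ∘ (false ∷_)} {P ∘ (true ∷_)} (P-local agree) (P-local (λ x t → sym (agree x t)))
  where
    agree : ∀ {σ} x → T (X x) → (false ∷ σ) x ≡ (true ∷ σ) x
    agree zero    t = ⊥-elim (zero∉X t)
    agree (suc x) _ = refl

product-of-halves : ∀ a₀ a₁ {p₀ p₁ q₀ q₁} N → a₀ * N ≡ p₀ * q₀ → a₁ * N ≡ p₁ * q₁ →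
                    p₀ ≡ p₁ ⊎ q₀ ≡ q₁ → (a₀ + a₁) * (2 * N) ≡ (p₀ + p₁) * (q₀ + q₁)
product-of-halves a₀ a₁ {p₀} {p₁} {q₀} {q₁} N e₀ e₁ p₀≡p₁⊎q₀≡q₁ = begin
  (a₀ + a₁) * (2 * N)     ≡⟨ double-distrib a₀ a₁ N ⟩
  2 * (a₀ * N + a₁ * N)   ≡⟨ cong₂ (λ x y → 2 * (x + y)) e₀ e₁ ⟩
  2 * (p₀ * q₀ + p₁ * q₁) ≡⟨ balance p₀≡p₁⊎q₀≡q₁ ⟩
  (p₀ + p₁) * (q₀ + q₁)   ∎
  where
    open ≡-Reasoning
    double-distrib : ∀ a b N → (a + b) * (2 * N) ≡ 2 * (a * N + b * N)
    double-distrib = solve-∀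
    equal-rows : ∀ p q r → 2 * (p * q + p * r) ≡ (p + p) * (q + r)
    equal-rows = solve-∀
    equal-columns : ∀ q p r → 2 * (p * q + r * q) ≡ (p + r) * (q + q)
    equal-columns = solve-∀
    balance : p₀ ≡ p₁ ⊎ q₀ ≡ q₁ → 2 * (p₀ * q₀ + p₁ * q₁) ≡ (p₀ + p₁) * (q₀ + q₁)
    balance (inj₁ refl) = equal-rows p₀ q₀ q₁
    balance (inj₂ refl) = equal-columns q₀ p₀ p₁

count-independent : ∀ {n} {X Y : Fin n → Bool} {P Q : Assignment n → Bool} →
                    DependsOnlyOn X P → DependsOnlyOn Y Q → Disjoint X Y →
                    count (λ σ → P σ ∧ Q σ) * 2 ^ n ≡ count P * count Q
count-independent {zero} {P = P} {Q} _ _ _ with P [] | Q []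
... | false | _     = refl
... | true  | false = refl
... | true  | true  = refl
count-independent {suc n} {X} {Y} {P} {Q} P-local Q-local disjoint =
  product-of-halves (both false) (both true) (2 ^ n) (halves false) (halves true) head-irrelevant
  where
    both : Bool → ℕ
    both b = count (λ σ → P (b ∷ σ) ∧ Q (b ∷ σ))
    halves : ∀ b → both b * 2 ^ n ≡ count (P ∘ (b ∷_)) * count (Q ∘ (b ∷_))
    halves b = count-independent {X = X ∘ suc} {Y ∘ suc} {P ∘ (b ∷_)} {Q ∘ (b ∷_)}
                 (dependsOnlyOn-∷ {P = P} P-local b) (dependsOnlyOn-∷ {P = Q} Q-local b) (disjoint ∘ suc)
    head-irrelevant : count (P ∘ (false ∷_)) ≡ count (P ∘ (true ∷_)) ⊎
                      count (Q ∘ (false ∷_)) ≡ count (Q ∘ (true ∷_))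
    head-irrelevant with T? (X zero)
    ... | yes zero∈X = inj₂ (count-head-irrelevant {P = Q} Q-local (disjoint zero zero∈X))
    ... | no  zero∉X = inj₁ (count-head-irrelevant {P = P} P-local zero∉X)

constantOn : ∀ {n} → Bool → (Fin n → Bool) → Assignment n → Bool
constantOn c X σ = allᵇ (λ x → not (X x ∧ (σ x xor c)))

monochromatic : ∀ {n} → (Fin n → Bool) → Assignment n → Bool
monochromatic X σ = constantOn false X σ ∨ constantOn true X σ

count-guarded : ∀ {n} b (R : Assignment n → Bool) →
                count (λ σ → b ∧ R σ) + count (λ σ → not b ∧ R σ) ≡ count R
count-guarded {n} false R = cong (_+ count R) (count-false n)
count-guarded {n} true  R = trans (cong (count R +_) (count-false n)) (+-identityʳ (count R))

count-constantOn : ∀ {n} c (X : Fin n → Bool) → count (constantOn c X) * 2 ^ size X ≡ 2 ^ n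
count-constantOn {zero}  c X = refl
count-constantOn {suc n} c X with X zero
... | false = trans (twice A p) (cong (2 *_) (count-constantOn c (X ∘ suc)))
  where
    A = count (constantOn c (X ∘ suc))
    p = 2 ^ size (X ∘ suc)
    twice : ∀ a p → (a + a) * p ≡ 2 * (a * p)
    twice = solve-∀
... | true = begin
  (count (λ σ → not c ∧ R σ) + count (λ σ → not (not c) ∧ R σ)) * (2 * p)
    ≡⟨ cong (_* (2 * p)) (count-guarded (not c) R) ⟩
  A * (2 * p) ≡⟨ *-assoc-comm A 2 p ⟩
  2 * (A * p) ≡⟨ cong (2 *_) (count-constantOn c (X ∘ suc)) ⟩
  2 * 2 ^ n   ∎
  where
    open ≡-Reasoning
    R = constantOn c (X ∘ suc)
    A = count R
    p = 2 ^ size (X ∘ suc)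
    *-assoc-comm : ∀ a b c → a * (b * c) ≡ b * (a * c)
    *-assoc-comm = solve-∀

count-monochromatic : ∀ {n} (X : Fin n → Bool) → count (monochromatic X) * 2 ^ size X ≤ 2 * 2 ^ n
count-monochromatic {n} X = begin
  count (monochromatic X) * 2 ^ size X
    ≤⟨ *-monoˡ-≤ (2 ^ size X) (count-∨ (constantOn false X) (constantOn true X)) ⟩
  (count (constantOn false X) + count (constantOn true X)) * 2 ^ size X
    ≡⟨ *-distribʳ-+ (2 ^ size X) (count (constantOn false X)) (count (constantOn true X)) ⟩
  count (constantOn false X) * 2 ^ size X + count (constantOn true X) * 2 ^ size X
    ≡⟨ cong₂ _+_ (count-constantOn false X) (count-constantOn true X) ⟩
  2 ^ n + 2 ^ n
    ≡⟨ cong (2 ^ n +_) (sym (+-identityʳ (2 ^ n))) ⟩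
  2 * 2 ^ n ∎
  where open ≤-Reasoning

constantOn-local : ∀ {n} c (X : Fin n → Bool) → DependsOnlyOn X (constantOn c X)
constantOn-local c X {σ} {τ} agree t = allᵇ⁺ (λ x → transport x (allᵇ⁻ t x))
  where
    transport : ∀ x → T (not (X x ∧ (σ x xor c))) → T (not (X x ∧ (τ x xor c)))
    transport x with X x in eq
    ... | false = id
    ... | true  = subst (λ b → T (not (b xor c))) (agree x (subst T (sym eq) tt))

monochromatic-local : ∀ {n} (X : Fin n → Bool) → DependsOnlyOn X (monochromatic X)
monochromatic-local X agree t =
  Equivalence.from T-∨ (Sum.map (constantOn-local false X agree) (constantOn-local true X agree) (Equivalence.to T-∨ t))

¬constantOn⇒∃ : ∀ {n} c (X : Fin n → Bool) σ → ¬ T (constantOn c X σ) → ∃[ x ] T (X x) × T (σ x xor c)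
¬constantOn⇒∃ c X σ ¬const =
  let x , ¬t = ¬allᵇ⇒∃ ¬const in x , Equivalence.to T-∧ (¬T-not ¬t)
  where
    ¬T-not : ∀ {b} → ¬ T (not b) → T b
    ¬T-not {false} f = f tt
    ¬T-not {true}  _ = tt

¬monochromatic⇒∃ : ∀ {n} (X : Fin n → Bool) σ → ¬ T (monochromatic X σ) →
                    ∃[ u ] ∃[ w ] T (X u) × T (X w) × σ u ≢ σ w
¬monochromatic⇒∃ X σ ¬mono =
  let u , u∈X , σu = ¬constantOn⇒∃ false X σ (¬mono ∘ Equivalence.from T-∨ ∘ inj₁)
      w , w∈X , σw = ¬constantOn⇒∃ true  X σ (¬mono ∘ Equivalence.from T-∨ ∘ inj₂)
  in u , w , u∈X , w∈X , λ σu≡σw →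
       T-not⁻ (subst T (trans (xor-comm (σ w) true) (true-xor (σ w))) σw)
              (subst T σu≡σw (subst T (xor-identityʳ (σ u)) σu))

-- The Lovász Local Lemma

dependents : ∀ {n m} → (Fin m → Fin n → Bool) → Fin m → Fin m → Bool
dependents V i = (λ j → meets (V i) (V j)) - i

^-exchange : ∀ {a b t d} → a ≤ b → t ≤ d → a ^ d * b ^ t ≤ a ^ t * b ^ d
^-exchange {a} {b} {t} {d} a≤b t≤d = begin
  a ^ d * b ^ t           ≡⟨ cong (λ e → a ^ e * b ^ t) (sym t+r≡d) ⟩
  a ^ (t + r) * b ^ t     ≡⟨ cong (_* b ^ t) (^-distribˡ-+-* a t r) ⟩
  a ^ t * a ^ r * b ^ t   ≤⟨ *-monoˡ-≤ (b ^ t) (*-monoʳ-≤ (a ^ t) (^-monoˡ-≤ r a≤b)) ⟩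
  a ^ t * b ^ r * b ^ t   ≡⟨ *-assoc (a ^ t) (b ^ r) (b ^ t) ⟩
  a ^ t * (b ^ r * b ^ t) ≡⟨ cong (a ^ t *_) (sym (^-distribˡ-+-* b r t)) ⟩
  a ^ t * b ^ (r + t)     ≡⟨ cong (λ e → a ^ t * b ^ e) (trans (+-comm r t) t+r≡d) ⟩
  a ^ t * b ^ d           ∎
  where
    open ≤-Reasoning
    r = d ∸ t
    t+r≡d : t + r ≡ d
    t+r≡d = m+[n∸m]≡n t≤d

complement-lower-bound : ∀ {A B C} D → A ≡ B + C → B * suc D ≤ A → D * A ≤ suc D * C
complement-lower-bound {A} {B} {C} D A≡B+C B[D+1]≤A = +-cancelʳ-≤ A (D * A) (suc D * C) (begin
  D * A + A             ≡⟨ +-comm (D * A) A ⟩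
  suc D * A             ≡⟨ cong (suc D *_) A≡B+C ⟩
  suc D * (B + C)       ≡⟨ *-distribˡ-+ (suc D) B C ⟩
  suc D * B + suc D * C ≡⟨ cong (_+ suc D * C) (*-comm (suc D) B) ⟩
  B * suc D + suc D * C ≤⟨ +-monoˡ-≤ (suc D * C) B[D+1]≤A ⟩
  A + suc D * C         ≡⟨ +-comm A (suc D * C) ⟩
  suc D * C + A         ∎)
  where open ≤-Reasoning

local-lemma-arithmetic : ∀ {x y N B e A t} D .{{_ : NonZero D}} → 0 < N → t ≤ D →
  x ≤ y → y * N ≡ B * e → e * suc D ^ suc D ≤ N * D ^ D → D ^ t * B ≤ suc D ^ t * A →
  x * suc D ≤ A
local-lemma-arithmetic {x} {y} {N} {B} {e} {A} {t} D N>0 t≤D x≤y independent rare shrink =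
  *-cancelʳ-≤ (x * suc D) A K {{>-nonZero K>0}} (begin
    x * suc D * K                     ≤⟨ *-monoˡ-≤ K (*-monoˡ-≤ (suc D) x≤y) ⟩
    y * suc D * K                     ≡⟨ regroup₁ y (suc D) N (D ^ t) (suc D ^ D) ⟩
    y * N * (D ^ t * suc D ^ suc D)   ≡⟨ cong (_* (D ^ t * suc D ^ suc D)) independent ⟩
    B * e * (D ^ t * suc D ^ suc D)   ≡⟨ regroup₂ B e (D ^ t) (suc D ^ suc D) ⟩
    e * suc D ^ suc D * (D ^ t * B)   ≤⟨ *-mono-≤ rare shrink ⟩
    N * D ^ D * (suc D ^ t * A)       ≡⟨ regroup₃ N (D ^ D) (suc D ^ t) A ⟩
    N * (D ^ D * suc D ^ t) * A       ≤⟨ *-monoˡ-≤ A (*-monoʳ-≤ N (^-exchange (n≤1+n D) t≤D)) ⟩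
    N * (D ^ t * suc D ^ D) * A       ≡⟨ regroup₄ N (D ^ t) (suc D ^ D) A ⟩
    A * K                             ∎)
  where
    open ≤-Reasoning
    K = N * D ^ t * suc D ^ D
    K>0 : 0 < K
    K>0 = *-mono-≤ (*-mono-≤ N>0 (m^n>0 D t)) (m^n>0 (suc D) D)
    regroup₁ : ∀ y s N p q → y * s * (N * p * q) ≡ y * N * (p * (s * q))
    regroup₁ = solve-∀
    regroup₂ : ∀ B e p q → B * e * (p * q) ≡ e * q * (p * B)
    regroup₂ = solve-∀
    regroup₃ : ∀ N a b A → N * a * (b * A) ≡ N * (a * b) * A
    regroup₃ = solve-∀
    regroup₄ : ∀ N a b A → N * (a * b) * A ≡ A * (N * a * b)
    regroup₄ = solve-∀

module LovaszLocalLemma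
  {n m : ℕ} (V : Fin m → Fin n → Bool) (E : Fin m → Assignment n → Bool)
  (E-local : ∀ i → DependsOnlyOn (V i) (E i))
  (D : ℕ) .{{_ : NonZero D}}
  (E-rare : ∀ i → count (E i) * suc D ^ suc D ≤ 2 ^ n * D ^ D)
  (few-dependents : ∀ i → size (dependents V i) ≤ D)
  where

  avoids : (Fin m → Bool) → Assignment n → Bool
  avoids J σ = allᵇ (λ j → not (J j ∧ E j σ))

  ConditionallyRare : (Fin m → Bool) → Set
  ConditionallyRare J = ∀ i → ¬ T (J i) → count (λ σ → avoids J σ ∧ E i σ) * suc D ≤ count (avoids J)

  avoids⁺ : ∀ J σ → (∀ j → T (J j) → ¬ T (E j σ)) → T (avoids J σ)
  avoids⁺ J σ none = allᵇ⁺ {f = λ j → not (J j ∧ E j σ)} λ j → T-not⁺ {J j ∧ E j σ} λ Jj∧Ej →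
    let Jj , Ej = Equivalence.to (T-∧ {J j}) Jj∧Ej in none j Jj Ej

  avoids⁻ : ∀ J σ → T (avoids J σ) → ∀ j → T (J j) → ¬ T (E j σ)
  avoids⁻ J σ avoidsJ j Jj Ej =
    T-not⁻ {J j ∧ E j σ} (allᵇ⁻ {f = λ j → not (J j ∧ E j σ)} avoidsJ j) (Equivalence.from (T-∧ {J j}) (Jj , Ej))

  avoids-antitone : ∀ {U J} → U ⊆ᵇ J → avoids J ⊆ᵇ avoids U
  avoids-antitone {U} {J} U⊆J {σ} avoidsJ = avoids⁺ U σ (λ j Uj → avoids⁻ J σ avoidsJ j (U⊆J Uj))

  count-avoids-remove : ∀ J j → T (J j) →
    count (avoids (J - j)) ≡ count (λ σ → avoids (J - j) σ ∧ E j σ) + count (avoids J)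
  count-avoids-remove J j j∈J =
    trans (count-split (avoids (J - j)) (E j))
          (cong (count (λ σ → avoids (J - j) σ ∧ E j σ) +_)
                (count-≐ {P = λ σ → avoids (J - j) σ ∧ not (E j σ)} {avoids J} into back))
    where
      into : (λ σ → avoids (J - j) σ ∧ not (E j σ)) ⊆ᵇ avoids J
      into {σ} t = avoids⁺ J σ λ x Jx Ex → case x ≟ j of λ where
          (yes refl) → T-not⁻ ¬Ej Ex
          (no x≢j)   → avoids⁻ (J - j) σ avoids′ x (subst T (sym (remove-≢ J x≢j)) Jx) Ex
        where
          avoids′ = proj₁ (Equivalence.to (T-∧ {avoids (J - j) σ}) t)
          ¬Ej = proj₂ (Equivalence.to (T-∧ {avoids (J - j) σ}) t)
      back : avoids J ⊆ᵇ (λ σ → avoids (J - j) σ ∧ not (E j σ))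
      back {σ} avoidsJ = Equivalence.from (T-∧ {avoids (J - j) σ})
        ( avoids-antitone {J - j} {J} (proj₁ ∘ Equivalence.to (T-∧ {J _})) avoidsJ
        , T-not⁺ (avoids⁻ J σ avoidsJ j j∈J) )

  count-avoids-⊆ : ∀ {J} → (∀ {W} → size W < size J → ConditionallyRare W) →
                  ∀ d {U} → U ⊆ᵇ J → size (J ∖ U) ≡ d →
                  D ^ d * count (avoids U) ≤ suc D ^ d * count (avoids J)
  count-avoids-⊆ {J} _ zero {U} _ J∖U-empty =
    *-monoʳ-≤ 1 (count-mono {P = avoids U} {avoids J} (avoids-antitone {J} {U} J⊆U))
    where
      J⊆U : J ⊆ᵇ U
      J⊆U {x} x∈J with U x in eq
      ... | true  = tt
      ... | false = contradiction J∖U-empty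
                      (>⇒≢ (∈⇒size>0 (J ∖ U) x (Equivalence.from T-∧ (x∈J , subst (T ∘ not) (sym eq) tt))))
  count-avoids-⊆ {J} rare (suc d) {U} U⊆J size≡1+d = begin
    D * D ^ d * count (avoids U)        ≡⟨ *-assoc D (D ^ d) _ ⟩
    D * (D ^ d * count (avoids U))      ≤⟨ *-monoʳ-≤ D (count-avoids-⊆ rare′ d {U} U⊆J′ size′≡d) ⟩
    D * (suc D ^ d * A)                 ≡⟨ swap D (suc D ^ d) A ⟩
    suc D ^ d * (D * A)                 ≤⟨ *-monoʳ-≤ (suc D ^ d) D*A≤[D+1]*C ⟩
    suc D ^ d * (suc D * C)             ≡⟨ regroup (suc D ^ d) (suc D) C ⟩
    suc D * suc D ^ d * C               ∎
    where
      open ≤-Reasoning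
      swap : ∀ a b c → a * (b * c) ≡ b * (a * c)
      swap = solve-∀
      regroup : ∀ a b c → a * (b * c) ≡ b * a * c
      regroup = solve-∀
      j∈J∖U = size>0⇒∃ (J ∖ U) (subst (0 <_) (sym size≡1+d) z<s)
      j = proj₁ j∈J∖U
      j∈J = proj₁ (Equivalence.to T-∧ (proj₂ j∈J∖U))
      j∉U = T-not⁻ (proj₂ (Equivalence.to T-∧ (proj₂ j∈J∖U)))
      J′ = J - j
      A = count (avoids J′)
      C = count (avoids J)
      size-J′ : size J ≡ suc (size J′)
      size-J′ = size-remove J j j∈J
      rare′ : ∀ {W} → size W < size J′ → ConditionallyRare W
      rare′ lt = rare (<-trans lt (≤-reflexive (sym size-J′)))
      U⊆J′ : U ⊆ᵇ J′
      U⊆J′ {x} x∈U with x ≟ j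
      ... | yes refl = contradiction x∈U j∉U
      ... | no  _    = subst T (sym (∧-identityʳ (J x))) (U⊆J x∈U)
      size′≡d : size (J′ ∖ U) ≡ d
      size′≡d = suc-injective (begin-equality
        suc (size (J′ ∖ U))        ≡⟨ cong suc (size-cong (λ x → ∧-swapʳ (J x) _ _)) ⟩
        suc (size ((J ∖ U) - j))   ≡⟨ sym (size-remove (J ∖ U) j (proj₂ j∈J∖U)) ⟩
        size (J ∖ U)               ≡⟨ size≡1+d ⟩
        suc d                      ∎)
      D*A≤[D+1]*C : D * A ≤ suc D * C
      D*A≤[D+1]*C = complement-lower-bound D (count-avoids-remove J j j∈J)
                      (rare (≤-reflexive (sym size-J′)) j (subst T (remove-self J j)))

  conditionally-rare-step : ∀ J → (∀ {W} → size W < size J → ConditionallyRare W) → ConditionallyRare J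
  conditionally-rare-step J rare i i∉J =
    local-lemma-arithmetic D (m^n>0 2 n) t≤D
      (count-mono {P = λ σ → avoids J σ ∧ E i σ} {λ σ → avoids J₂ σ ∧ E i σ} narrow)
      (count-independent {X = not ∘ V i} {V i} {avoids J₂} {E i} avoids-J₂-local (E-local i)
                         (λ x x∉Vi x∈Vi → T-not⁻ x∉Vi x∈Vi))
      (E-rare i)
      (count-avoids-⊆ rare t {J₂} J₂⊆J refl)
    where
      -- J ∖ J₂ consists of at most D events; E i is independent of avoiding J₂.
      J₂ : Fin m → Bool
      J₂ j = J j ∧ not (meets (V i) (V j))
      t = size (J ∖ J₂)
      J₂⊆J : J₂ ⊆ᵇ J
      J₂⊆J = proj₁ ∘ Equivalence.to T-∧
      narrow : (λ σ → avoids J σ ∧ E i σ) ⊆ᵇ (λ σ → avoids J₂ σ ∧ E i σ)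
      narrow {σ} t = let avoidsJ , Ei = Equivalence.to (T-∧ {avoids J σ}) t
                     in Equivalence.from (T-∧ {avoids J₂ σ}) (avoids-antitone {J₂} {J} J₂⊆J avoidsJ , Ei)
      J∖J₂⊆dependents : (J ∖ J₂) ⊆ᵇ dependents V i
      J∖J₂⊆dependents {x} x∈J∖J₂ =
        subst T (sym (remove-≢ (λ j → meets (V i) (V j)) (λ { refl → i∉J x∈J }))) meets-x
        where
          x∈J = proj₁ (Equivalence.to (T-∧ {J x}) x∈J∖J₂)
          x∉J₂ = proj₂ (Equivalence.to (T-∧ {J x}) x∈J∖J₂)
          meets-x : T (meets (V i) (V x))
          meets-x = decidable-stable (T? _) λ ¬meets →
            T-not⁻ x∉J₂ (Equivalence.from (T-∧ {J x}) (x∈J , T-not⁺ ¬meets))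
      t≤D : t ≤ D
      t≤D = ≤-trans (size-mono {X = J ∖ J₂} {dependents V i} J∖J₂⊆dependents) (few-dependents i)
      avoids-J₂-local : DependsOnlyOn (not ∘ V i) (avoids J₂)
      avoids-J₂-local {σ} {τ} agree avoidsσ = avoids⁺ J₂ τ λ j j∈J₂ Ejτ →
        avoids⁻ J₂ σ avoidsσ j j∈J₂ (E-local j (λ x x∈Vj → sym (agree x (outside j j∈J₂ x x∈Vj))) Ejτ)
        where
          outside : ∀ j → T (J₂ j) → ∀ x → T (V j x) → T (not (V i x))
          outside j j∈J₂ x x∈Vj = T-not⁺ λ x∈Vi →
            ¬meets⇒disjoint {X = V i} {V j} (T-not⁻ (proj₂ (Equivalence.to (T-∧ {J j}) j∈J₂))) x x∈Vi x∈Vj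

  conditionally-rare : ∀ J → ConditionallyRare J
  conditionally-rare = All.wfRec (On.wellFounded size <-wellFounded) 0ℓ ConditionallyRare conditionally-rare-step

  all-avoidable : ∃[ σ ] (∀ i → ¬ T (E i σ))
  all-avoidable = σ , λ i → avoids⁻ everything σ avoids-all i tt
    where
      everything nothing : Fin m → Bool
      everything _ = true
      nothing _ = false
      d = size everything
      bound : D ^ d * count (avoids nothing) ≤ suc D ^ d * count (avoids everything)
      bound = count-avoids-⊆ (λ {W} _ → conditionally-rare W) d {nothing} (λ ()) refl
      count-avoids-nothing : count (avoids nothing) ≡ 2 ^ n
      count-avoids-nothing =
        trans (count-≐ {P = avoids nothing} {λ _ → true} (λ _ → tt) (λ {σ} _ → avoids⁺ nothing σ λ _ ()))
              (count-true n)
      positive : 0 < count (avoids everything)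
      positive = n≢0⇒n>0 λ none → <⇒≱ lower (begin
        D ^ d * count (avoids nothing)       ≤⟨ bound ⟩
        suc D ^ d * count (avoids everything) ≡⟨ cong (suc D ^ d *_) none ⟩
        suc D ^ d * 0                        ≡⟨ *-zeroʳ (suc D ^ d) ⟩
        0                                    ∎)
        where
          open ≤-Reasoning
          lower : 0 < D ^ d * count (avoids nothing)
          lower = subst (λ c → 0 < D ^ d * c) (sym count-avoids-nothing) (*-mono-≤ (m^n>0 D d) (m^n>0 2 n))
      σ = proj₁ (count>0⇒∃ (avoids everything) positive)
      avoids-all = proj₂ (count>0⇒∃ (avoids everything) positive)

-- The partial sums of e

-- Pascal's rule as the definition: the library's _C_ is defined by division.
binomial : ℕ → ℕ → ℕ
binomial _       zero    = 1
binomial zero    (suc k) = 0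
binomial (suc j) (suc k) = binomial j k + binomial j (suc k)

∑≤ : ℕ → (ℕ → ℕ) → ℕ
∑≤ zero    f = f 0
∑≤ (suc j) f = f 0 + ∑≤ j (f ∘ suc)

∑≤-cong : ∀ j {f g} → (∀ k → f k ≡ g k) → ∑≤ j f ≡ ∑≤ j g
∑≤-cong zero    f≗g = f≗g 0
∑≤-cong (suc j) f≗g = cong₂ _+_ (f≗g 0) (∑≤-cong j (f≗g ∘ suc))

∑≤-mono : ∀ j {f g} → (∀ k → k ≤ j → f k ≤ g k) → ∑≤ j f ≤ ∑≤ j g
∑≤-mono zero    f≤g = f≤g 0 z≤n
∑≤-mono (suc j) f≤g = +-mono-≤ (f≤g 0 z≤n) (∑≤-mono j (λ k k≤j → f≤g (suc k) (s≤s k≤j)))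

∑≤-+ : ∀ j f g → ∑≤ j (λ k → f k + g k) ≡ ∑≤ j f + ∑≤ j g
∑≤-+ zero    f g = refl
∑≤-+ (suc j) f g = trans (cong (f 0 + g 0 +_) (∑≤-+ j (f ∘ suc) (g ∘ suc))) (+-interchange (f 0) (g 0) _ _)

∑≤-*ˡ : ∀ j c f → ∑≤ j (λ k → c * f k) ≡ c * ∑≤ j f
∑≤-*ˡ zero    c f = refl
∑≤-*ˡ (suc j) c f = trans (cong (c * f 0 +_) (∑≤-*ˡ j c (f ∘ suc))) (sym (*-distribˡ-+ c (f 0) _))

∑≤-*ʳ : ∀ j c f → ∑≤ j (λ k → f k * c) ≡ ∑≤ j f * c
∑≤-*ʳ j c f = trans (∑≤-cong j (λ k → *-comm (f k) c)) (trans (∑≤-*ˡ j c f) (*-comm c (∑≤ j f)))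

∑≤-drop-last : ∀ j f → f (suc j) ≡ 0 → ∑≤ (suc j) f ≡ ∑≤ j f
∑≤-drop-last zero    f f1≡0 = trans (cong (f 0 +_) f1≡0) (+-identityʳ (f 0))
∑≤-drop-last (suc j) f last≡0 = cong (f 0 +_) (∑≤-drop-last j (f ∘ suc) last≡0)

binomial-vanishes : ∀ {j k} → j < k → binomial j k ≡ 0
binomial-vanishes {zero}  {suc k} _         = refl
binomial-vanishes {suc j} {suc k} (s≤s j<k) =
  cong₂ _+_ (binomial-vanishes j<k) (binomial-vanishes (m<n⇒m<1+n j<k))

binomial-theorem : ∀ D j → suc D ^ j ≡ ∑≤ j (λ k → binomial j k * D ^ k)
binomial-theorem D zero    = refl
binomial-theorem D (suc j) = sym (begin
  1 + ∑≤ j (λ k → (binomial j k + binomial j (suc k)) * (D * D ^ k))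
    ≡⟨ cong (1 +_) (trans (∑≤-cong j (λ k → distrib (binomial j k) (binomial j (suc k)) D (D ^ k)))
                          (∑≤-+ j _ _)) ⟩
  1 + (∑≤ j (λ k → D * (binomial j k * D ^ k)) + R)
    ≡⟨ cong (λ x → 1 + (x + R)) (∑≤-*ˡ j D _) ⟩
  1 + (D * S + R)   ≡⟨ rotate (D * S) R ⟩
  D * S + (1 + R)   ≡⟨ cong (D * S +_) (∑≤-drop-last j _ (cong (_* D ^ suc j) (binomial-vanishes (n<1+n j)))) ⟩
  D * S + S         ≡⟨ +-comm (D * S) S ⟩
  suc D * S         ≡⟨ cong (suc D *_) (sym (binomial-theorem D j)) ⟩
  suc D * suc D ^ j ∎)
  where
    open ≡-Reasoning
    S = ∑≤ j (λ k → binomial j k * D ^ k)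
    R = ∑≤ j (λ k → binomial j (suc k) * D ^ suc k)
    distrib : ∀ a b D p → (a + b) * (D * p) ≡ D * (a * p) + b * (D * p)
    distrib = solve-∀
    rotate : ∀ a b → 1 + (a + b) ≡ a + (1 + b)
    rotate = solve-∀

binomial-absorption : ∀ j k → suc k * binomial (suc j) (suc k) ≡ suc j * binomial j k
binomial-absorption zero    zero    = refl
binomial-absorption zero    (suc k) = *-zeroʳ (suc (suc k))
binomial-absorption (suc j) zero    =
  trans (*-identityˡ _) (trans (binomial-1 (suc (suc j))) (sym (*-identityʳ _)))
  where
    binomial-1 : ∀ j → binomial j 1 ≡ j
    binomial-1 zero    = refl
    binomial-1 (suc j) = cong suc (binomial-1 j)
binomial-absorption (suc j) (suc k) = begin
  suc (suc k) * (binomial (suc j) (suc k) + binomial (suc j) (suc (suc k)))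
    ≡⟨ split (suc k) (binomial (suc j) (suc k)) (binomial (suc j) (suc (suc k))) ⟩
  suc k * binomial (suc j) (suc k) + binomial (suc j) (suc k) + suc (suc k) * binomial (suc j) (suc (suc k))
    ≡⟨ cong₂ (λ a b → a + binomial (suc j) (suc k) + b) (binomial-absorption j k) (binomial-absorption j (suc k)) ⟩
  suc j * binomial j k + (binomial j k + binomial j (suc k)) + suc j * binomial j (suc k)
    ≡⟨ merge (suc j) (binomial j k) (binomial j (suc k)) ⟩
  suc (suc j) * (binomial j k + binomial j (suc k)) ∎
  where
    open ≡-Reasoning
    split : ∀ s a b → suc s * (a + b) ≡ s * a + a + suc s * b
    split = solve-∀
    merge : ∀ s a b → s * a + (a + b) + s * b ≡ suc s * (a + b)
    merge = solve-∀

eFact-binomial : ∀ j → eFact j ≡ ∑≤ j (λ k → binomial j k * k !)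
eFact-binomial zero    = refl
eFact-binomial (suc j) = sym (begin
  1 + ∑≤ j (λ k → binomial (suc j) (suc k) * (suc k * k !))
    ≡⟨ cong (1 +_) (∑≤-cong j absorb) ⟩
  1 + ∑≤ j (λ k → suc j * (binomial j k * k !))
    ≡⟨ cong (1 +_) (∑≤-*ˡ j (suc j) _) ⟩
  1 + suc j * ∑≤ j (λ k → binomial j k * k !)
    ≡⟨ cong (λ e → 1 + suc j * e) (sym (eFact-binomial j)) ⟩
  1 + suc j * eFact j
    ≡⟨ +-comm 1 (suc j * eFact j) ⟩
  suc j * eFact j + 1 ∎)
  where
    open ≡-Reasoning
    regroup : ∀ a b c → a * (b * c) ≡ b * a * c
    regroup = solve-∀
    absorb : ∀ k → binomial (suc j) (suc k) * (suc k * k !) ≡ suc j * (binomial j k * k !)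
    absorb k = begin
      binomial (suc j) (suc k) * (suc k * k !) ≡⟨ regroup (binomial (suc j) (suc k)) (suc k) (k !) ⟩
      suc k * binomial (suc j) (suc k) * k !   ≡⟨ cong (_* k !) (binomial-absorption j k) ⟩
      suc j * binomial j k * k !               ≡⟨ *-assoc (suc j) (binomial j k) (k !) ⟩
      suc j * (binomial j k * k !)             ∎

factorial-≤ : ∀ k r {D} → k + r ≤ D → (k + r) ! ≤ D ^ r * k !
factorial-≤ k zero    _   rewrite +-identityʳ k = ≤-reflexive (sym (+-identityʳ (k !)))
factorial-≤ k (suc r) {D} k+r<D rewrite +-suc k r = begin
  suc (k + r) * (k + r) ! ≤⟨ *-mono-≤ k+r<D (factorial-≤ k r (≤-trans (n≤1+n _) k+r<D)) ⟩
  D * (D ^ r * k !)       ≡⟨ sym (*-assoc D (D ^ r) (k !)) ⟩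
  D * D ^ r * k !         ∎
  where open ≤-Reasoning

[1+1/D]^D≤eFact : ∀ D → suc D ^ D * D ! ≤ D ^ D * eFact D
[1+1/D]^D≤eFact D = begin
  suc D ^ D * D !                                  ≡⟨ cong (_* D !) (binomial-theorem D D) ⟩
  ∑≤ D (λ k → binomial D k * D ^ k) * D !          ≡⟨ sym (∑≤-*ʳ D (D !) _) ⟩
  ∑≤ D (λ k → binomial D k * D ^ k * D !)          ≤⟨ ∑≤-mono D term ⟩
  ∑≤ D (λ k → D ^ D * (binomial D k * k !))        ≡⟨ ∑≤-*ˡ D (D ^ D) _ ⟩
  D ^ D * ∑≤ D (λ k → binomial D k * k !)          ≡⟨ cong (D ^ D *_) (sym (eFact-binomial D)) ⟩
  D ^ D * eFact D                                  ∎
  where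
    open ≤-Reasoning
    regroup : ∀ a b c → a * (b * c) ≡ b * (a * c)
    regroup = solve-∀
    term : ∀ k → k ≤ D → binomial D k * D ^ k * D ! ≤ D ^ D * (binomial D k * k !)
    term k k≤D = begin
      binomial D k * D ^ k * D !       ≡⟨ *-assoc (binomial D k) (D ^ k) (D !) ⟩
      binomial D k * (D ^ k * D !)     ≤⟨ *-monoʳ-≤ (binomial D k) powers ⟩
      binomial D k * (D ^ D * k !)     ≡⟨ regroup (binomial D k) (D ^ D) (k !) ⟩
      D ^ D * (binomial D k * k !)     ∎
      where
        r = D ∸ k
        k+r≡D : k + r ≡ D
        k+r≡D = m+[n∸m]≡n k≤D
        powers : D ^ k * D ! ≤ D ^ D * k !
        powers = begin
          D ^ k * D !           ≡⟨ cong (λ x → D ^ k * x !) (sym k+r≡D) ⟩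
          D ^ k * (k + r) !     ≤⟨ *-monoʳ-≤ (D ^ k) (factorial-≤ k r (≤-reflexive k+r≡D)) ⟩
          D ^ k * (D ^ r * k !) ≡⟨ sym (*-assoc (D ^ k) (D ^ r) (k !)) ⟩
          D ^ k * D ^ r * k !   ≡⟨ cong (_* k !) (sym (^-distribˡ-+-* D k r)) ⟩
          D ^ (k + r) * k !     ≡⟨ cong (λ e → D ^ e * k !) k+r≡D ⟩
          D ^ D * k !           ∎

EulerBound⇒local-lemma-condition : ∀ {Δ δ} D → suc D ≡ Δ * Δ → EulerBound Δ δ →
                                    2 * suc D ^ suc D ≤ 2 ^ δ * D ^ D
EulerBound⇒local-lemma-condition {Δ} {δ} D [D+1]≡Δ² euler =
  *-cancelʳ-≤ (2 * suc D ^ suc D) (2 ^ δ * D ^ D) (D !) {{D !≢0}} (begin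
    2 * (suc D * suc D ^ D) * D ! ≡⟨ regroup₁ (suc D) (suc D ^ D) (D !) ⟩
    2 * suc D * (suc D ^ D * D !) ≤⟨ *-monoʳ-≤ (2 * suc D) ([1+1/D]^D≤eFact D) ⟩
    2 * suc D * (D ^ D * eFact D) ≡⟨ regroup₂ (suc D) (D ^ D) (eFact D) ⟩
    D ^ D * (2 * (eFact D * suc D)) ≡⟨ cong (λ x → D ^ D * (2 * (eFact D * x))) [D+1]≡Δ² ⟩
    D ^ D * (2 * (eFact D * (Δ * Δ))) ≤⟨ *-monoʳ-≤ (D ^ D) (euler D) ⟩
    D ^ D * (2 ^ δ * D !)         ≡⟨ regroup₃ (D ^ D) (2 ^ δ) (D !) ⟩
    2 ^ δ * D ^ D * D !           ∎)
  where
    open ≤-Reasoning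
    regroup₁ : ∀ a b c → 2 * (a * b) * c ≡ 2 * a * (b * c)
    regroup₁ = solve-∀
    regroup₂ : ∀ a b c → 2 * a * (b * c) ≡ b * (2 * (c * a))
    regroup₂ = solve-∀
    regroup₃ : ∀ a b c → a * (b * c) ≡ b * a * c
    regroup₃ = solve-∀

EulerBound⇒2≤Δ : ∀ {Δ δ} → 1 ≤ Δ → δ ≤ Δ → EulerBound Δ δ → 2 ≤ Δ
EulerBound⇒2≤Δ {suc (suc _)} _ _ _ = s≤s (s≤s z≤n)
EulerBound⇒2≤Δ {suc zero} {δ} _ δ≤1 euler =
  contradiction (≤-trans (euler 1) (≤-trans (≤-reflexive (*-identityʳ (2 ^ δ))) (^-monoʳ-≤ 2 δ≤1)))
                λ { (s≤s (s≤s ())) }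

≤-foldr-⊔ : ∀ {k} (f : Fin k → ℕ) i → f i ≤ foldr _⊔_ 0 (tabulate f)
≤-foldr-⊔ f zero    = m≤m⊔n (f zero) _
≤-foldr-⊔ f (suc i) = ≤-trans (≤-foldr-⊔ (f ∘ suc) i) (m≤n⊔m (f zero) _)

foldr-⊓-≤ : ∀ {k} e (f : Fin k → ℕ) i → foldr _⊓_ e (tabulate f) ≤ f i
foldr-⊓-≤ e f zero    = m⊓n≤m (f zero) _
foldr-⊓-≤ e f (suc i) = ≤-trans (m⊓n≤n (f zero) _) (foldr-⊓-≤ e (f ∘ suc) i)

sum-tabulate-mono : ∀ {k} {f g : Fin k → ℕ} → (∀ i → f i ≤ g i) → sum (tabulate f) ≤ sum (tabulate g)
sum-tabulate-mono {zero}  _   = z≤n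
sum-tabulate-mono {suc k} f≤g = +-mono-≤ (f≤g zero) (sum-tabulate-mono (f≤g ∘ suc))

m*[m∸1]≤m*m∸1 : ∀ m → m * (m ∸ 1) ≤ m * m ∸ 1
m*[m∸1]≤m*m∸1 zero    = z≤n
m*[m∸1]≤m*m∸1 (suc k) = begin
  suc k * (suc k ∸ 1)     ≡⟨ *-distribˡ-∸ (suc k) (suc k) 1 ⟩
  suc k * suc k ∸ suc k * 1 ≤⟨ ∸-monoʳ-≤ {1} {suc k * 1} (suc k * suc k) (s≤s z≤n) ⟩
  suc k * suc k ∸ 1       ∎
  where open ≤-Reasoning

module _ {n} (G : Graph n) where

  deg≡size : ∀ v → deg G v ≡ size (adj G v)
  deg≡size v = cong sum (map-tabulate id (λ u → if adj G v u then 1 else 0))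

  Adj⇒0<deg : ∀ {v u} → Adj G v u → 0 < deg G v
  Adj⇒0<deg {v} {u} vu = subst (0 <_) (sym (deg≡size v)) (∈⇒size>0 (adj G v) u vu)

  deg≤maxDeg : ∀ v → deg G v ≤ maxDeg G
  deg≤maxDeg v = subst (deg G v ≤_) (cong (foldr _⊔_ 0) (sym (map-tabulate id (deg G)))) (≤-foldr-⊔ (deg G) v)

  minDeg≤deg : ∀ v → minDeg G ≤ deg G v
  minDeg≤deg v = subst (_≤ deg G v) (cong (foldr _⊓_ n) (sym (map-tabulate id (deg G)))) (foldr-⊓-≤ n (deg G) v)

  size-adj≤maxDeg : ∀ v → size (adj G v) ≤ maxDeg G
  size-adj≤maxDeg v = subst (_≤ maxDeg G) (deg≡size v) (deg≤maxDeg v)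

  minDeg≤size-adj : ∀ v → minDeg G ≤ size (adj G v)
  minDeg≤size-adj v = subst (minDeg G ≤_) (deg≡size v) (minDeg≤deg v)

  size-dependents : ∀ i → size (dependents (adj G) i) ≤ maxDeg G * maxDeg G ∸ 1
  size-dependents i = begin
    size (dependents (adj G) i)                              ≤⟨ size-mono {X = dependents (adj G) i} dependents⊆⋃ ⟩
    size (λ j → anyᵇ (λ u → via u j))                        ≤⟨ size-⋃ via ⟩
    sum (tabulate (λ u → size (via u)))                      ≤⟨ sum-tabulate-mono size-via ⟩
    sum (tabulate (λ u → if adj G i u then Δ ∸ 1 else 0))    ≡⟨ sum-indicator (adj G i) (Δ ∸ 1) ⟩
    size (adj G i) * (Δ ∸ 1)                                 ≤⟨ *-monoˡ-≤ (Δ ∸ 1) (size-adj≤maxDeg i) ⟩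
    Δ * (Δ ∸ 1)                                              ≤⟨ m*[m∸1]≤m*m∸1 Δ ⟩
    Δ * Δ ∸ 1                                                ∎
    where
      open ≤-Reasoning
      Δ = maxDeg G
      via : Fin n → Fin n → Bool
      via u = λ j → adj G i u ∧ (adj G u - i) j
      dependents⊆⋃ : dependents (adj G) i ⊆ᵇ (λ j → anyᵇ (λ u → via u j))
      dependents⊆⋃ {j} j∈dep =
        anyᵇ⁺ {f = λ u → via u j} u
          (Equivalence.from (T-∧ {adj G i u}) (iu , Equivalence.from (T-∧ {adj G u j}) (uj , j≢i)))
        where
          meets-ij = proj₁ (Equivalence.to (T-∧ {meets (adj G i) (adj G j)}) j∈dep)
          j≢i = proj₂ (Equivalence.to (T-∧ {meets (adj G i) (adj G j)}) j∈dep)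
          common = anyᵇ⁻ {f = λ x → adj G i x ∧ adj G j x} meets-ij
          u = proj₁ common
          iu = proj₁ (Equivalence.to (T-∧ {adj G i u}) (proj₂ common))
          uj = subst T (Graph.sym G j u) (proj₂ (Equivalence.to (T-∧ {adj G i u}) (proj₂ common)))
      size-via : ∀ u → size (via u) ≤ (if adj G i u then Δ ∸ 1 else 0)
      size-via u with adj G i u in iu
      ... | false = ≤-reflexive (size-∅ {n})
      ... | true  = begin
        size (adj G u - i)         ≡⟨ cong (_∸ 1) (size-remove (adj G u) i i∈N[u]) ⟨
        size (adj G u) ∸ 1         ≤⟨ ∸-monoˡ-≤ 1 (size-adj≤maxDeg u) ⟩
        Δ ∸ 1                      ∎
        where
          i∈N[u] : Adj G u i
          i∈N[u] = subst T (trans (sym iu) (Graph.sym G i u)) tt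

  monochromatic-neighbourhood-rare : ∀ {D} → 2 * suc D ^ suc D ≤ 2 ^ minDeg G * D ^ D → ∀ v →
                                     count (monochromatic (adj G v)) * suc D ^ suc D ≤ 2 ^ n * D ^ D
  monochromatic-neighbourhood-rare {D} condition v = *-cancelʳ-≤ _ _ 2 (begin
    c * suc D ^ suc D * 2            ≡⟨ regroup₁ c (suc D ^ suc D) ⟩
    c * (2 * suc D ^ suc D)          ≤⟨ *-monoʳ-≤ c condition ⟩
    c * (2 ^ minDeg G * D ^ D)       ≡⟨ *-assoc c (2 ^ minDeg G) (D ^ D) ⟨
    c * 2 ^ minDeg G * D ^ D         ≤⟨ *-monoˡ-≤ (D ^ D) (*-monoʳ-≤ c (^-monoʳ-≤ 2 (minDeg≤size-adj v))) ⟩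
    c * 2 ^ size (adj G v) * D ^ D   ≤⟨ *-monoˡ-≤ (D ^ D) (count-monochromatic (adj G v)) ⟩
    2 * 2 ^ n * D ^ D                ≡⟨ regroup₂ (2 ^ n) (D ^ D) ⟩
    2 ^ n * D ^ D * 2                ∎)
    where
      open ≤-Reasoning
      c = count (monochromatic (adj G v))
      regroup₁ : ∀ a b → a * b * 2 ≡ a * (2 * b)
      regroup₁ = solve-∀
      regroup₂ : ∀ a b → 2 * a * b ≡ a * b * 2
      regroup₂ = solve-∀

  neighbourhoods-splittable : EulerBound (maxDeg G) (minDeg G) → 2 ≤ maxDeg G →
                              ∃[ σ ] (∀ v → ¬ T (monochromatic (adj G v) σ))
  neighbourhoods-splittable euler 2≤Δ =
    LovaszLocalLemma.all-avoidable (adj G) (monochromatic ∘ adj G) (monochromatic-local ∘ adj G)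
      D {{>-nonZero 0<D}}
      (monochromatic-neighbourhood-rare {D} (EulerBound⇒local-lemma-condition {Δ} {minDeg G} D [D+1]≡Δ² euler))
      size-dependents
    where
      Δ = maxDeg G
      D = Δ * Δ ∸ 1
      4≤Δ² : 4 ≤ Δ * Δ
      4≤Δ² = *-mono-≤ 2≤Δ 2≤Δ
      [D+1]≡Δ² : suc D ≡ Δ * Δ
      [D+1]≡Δ² = trans (+-comm 1 D) (m∸n+n≡m (≤-trans (s≤s z≤n) 4≤Δ²))
      0<D : 0 < D
      0<D = ≤-trans (s≤s z≤n) (∸-monoˡ-≤ 1 4≤Δ²)

combine-injective : ∀ {m k} (i i′ : Fin m) {j j′ : Fin k} →
                    combine i j ≡ combine i′ j′ → i ≡ i′ × j ≡ j′
combine-injective {k = k} i i′ {j} {j′} eq =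
  ,-injective (trans (sym (remQuot-combine i j)) (trans (cong (remQuot k) eq) (remQuot-combine i′ j′)))

join-injective : ∀ {m k} {x y : Fin m ⊎ Fin k} → join m k x ≡ join m k y → x ≡ y
join-injective {m} {k} {x} {y} eq = trans (sym (splitAt-join m k x)) (trans (cong (splitAt m) eq) (splitAt-join m k y))

module _ {n} (G : Graph n) (S : Subset n) {a b}
         (outer : ProperColouringOn G (∁ S) a) (inner : ProperColouringOn G S b) where

  private
    c₁ = proj₁ outer
    c₂ = proj₁ inner

  side : Fin n → Fin a ⊎ Fin b
  side v with v ∈? S
  ... | yes v∈S = inj₂ (c₂ v v∈S)
  ... | no  v∉S = inj₁ (c₁ v (x∉p⇒x∈∁p v∉S))

  joined : Fin n → Fin (a + b)
  joined = join a b ∘ side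

  side-inner : ∀ {v} (v∈S : v ∈ S) → side v ≡ inj₂ (c₂ v v∈S)
  side-inner {v} v∈S with v ∈? S
  ... | yes v∈S′ = cong (inj₂ ∘ c₂ v) ([]=-irrelevant v∈S′ v∈S)
  ... | no  v∉S  = contradiction v∈S v∉S

  side-outer : ∀ {v} (v∈∁S : v ∈ ∁ S) → side v ≡ inj₁ (c₁ v v∈∁S)
  side-outer {v} v∈∁S with v ∈? S
  ... | yes v∈S = contradiction v∈S (x∈∁p⇒x∉p v∈∁S)
  ... | no  v∉S = cong (inj₁ ∘ c₁ v) ([]=-irrelevant (x∉p⇒x∈∁p v∉S) v∈∁S)

  joined-inner-outer : ∀ {u w} → u ∈ S → w ∉ S → joined u ≢ joined w
  joined-inner-outer u∈S w∉S eq
    with trans (sym (side-inner u∈S)) (trans (join-injective eq) (side-outer (x∉p⇒x∈∁p w∉S)))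
  ... | ()

  joined-inner : ∀ {u w} (u∈S : u ∈ S) (w∈S : w ∈ S) → c₂ u u∈S ≢ c₂ w w∈S → joined u ≢ joined w
  joined-inner u∈S w∈S c₂u≢c₂w eq =
    c₂u≢c₂w (inj₂-injective (trans (sym (side-inner u∈S)) (trans (join-injective eq) (side-inner w∈S))))

  joined-proper : ∀ u v → Adj G u v → joined u ≢ joined v
  joined-proper u v uv = case ((u ∈? S) , (v ∈? S)) of λ where
    (yes u∈S , yes v∈S) → joined-inner u∈S v∈S (proj₂ inner u v u∈S v∈S uv)
    (yes u∈S , no  v∉S) → joined-inner-outer u∈S v∉S
    (no  u∉S , yes v∈S) → joined-inner-outer v∈S u∉S ∘ sym
    (no  u∉S , no  v∉S) → λ eq →
      let u∈∁S = x∉p⇒x∈∁p u∉S ; v∈∁S = x∉p⇒x∈∁p v∉S in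
      proj₂ outer u v u∈∁S v∈∁S uv
        (inj₁-injective (trans (sym (side-outer u∈∁S)) (trans (join-injective eq) (side-outer v∈∁S))))

module _ {n} (G : Graph n) (S : Subset n) {b} (inner : ProperColouringOn G S b) (σ : Assignment n) where

  private
    bit : Bool → Fin 2
    bit = Inverse.from 2↔Bool

    bit-injective : ∀ {b c} → bit b ≡ bit c → b ≡ c
    bit-injective {b} {c} eq = trans (sym (Inverse.strictlyInverseˡ 2↔Bool b))
                                     (trans (cong (Inverse.to 2↔Bool) eq) (Inverse.strictlyInverseˡ 2↔Bool c))

  doubled : ProperColouringOn G S (2 * b)
  doubled = (λ v v∈S → combine (bit (σ v)) (proj₁ inner v v∈S))
          , λ u v u∈S v∈S uv eq →
              proj₂ inner u v u∈S v∈S uv (proj₂ (combine-injective (bit (σ u)) (bit (σ v)) eq))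

  doubled-separates : ∀ {u w} (u∈S : u ∈ S) (w∈S : w ∈ S) → σ u ≢ σ w →
                      proj₁ doubled u u∈S ≢ proj₁ doubled w w∈S
  doubled-separates {u} {w} u∈S w∈S σu≢σw eq =
    σu≢σw (bit-injective (proj₁ (combine-injective (bit (σ u)) (bit (σ w)) eq)))

total-dominating⇒dynamic : ∀ {n} (G : Graph n) (S : Subset n) {a b} →
  EulerBound (maxDeg G) (minDeg G) → IsTotalDominating G S → ∃[ v ] (v ∉ S) →
  ProperColouringOn G (∁ S) a → ProperColouringOn G S b → DynamicColouring G (a + 2 * b)
total-dominating⇒dynamic {n} G S euler dominating (v₀ , _) outer inner =
  colour , joined-proper G S outer inner₂ , λ v _ → distinguishing-neighbours v
  where
    2≤Δ : 2 ≤ maxDeg G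
    2≤Δ = EulerBound⇒2≤Δ {maxDeg G} {minDeg G}
            (≤-trans (Adj⇒0<deg G (proj₁ (proj₂ (dominating v₀)))) (deg≤maxDeg G v₀))
            (≤-trans (minDeg≤deg G v₀) (deg≤maxDeg G v₀)) euler
    -- Opaque, or the type checker evaluates the proof of the local lemma.
    opaque
      σ : Assignment n
      σ = proj₁ (neighbourhoods-splittable G euler 2≤Δ)
      splits : ∀ v → ¬ T (monochromatic (adj G v) σ)
      splits = proj₂ (neighbourhoods-splittable G euler 2≤Δ)
    inner₂ = doubled G S inner σ
    colour = joined G S outer inner₂
    distinguishing-neighbours : ∀ v → ∃[ u ] ∃[ w ] (Adj G v u × Adj G v w × colour u ≢ colour w)
    distinguishing-neighbours v with any? (λ w → T? (adj G v w) ×-dec ¬? (w ∈? S))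
    ... | yes (w , vw , w∉S) =
      let u , vu , u∈S = dominating v in u , w , vu , vw , joined-inner-outer G S outer inner₂ u∈S w∉S
    ... | no no-outer-neighbour =
      let u , w , vu , vw , σu≢σw = ¬monochromatic⇒∃ (adj G v) σ (splits v)
          inside : ∀ {x} → Adj G v x → x ∈ S
          inside {x} vx = decidable-stable (x ∈? S) (λ x∉S → no-outer-neighbour (x , vx , x∉S))
      in u , w , vu , vw , joined-inner G S outer inner₂ (inside vu) (inside vw)
                             (doubled-separates G S inner σ (inside vu) (inside vw) σu≢σw)

double-total-dominating⇒dynamic : ∀ {n} (G : Graph n) (S : Subset n) {a b} → IsDoubleTotalDominating G S →
  ProperColouringOn G (∁ S) a → ProperColouringOn G S b → DynamicColouring G (a + b)
double-total-dominating⇒dynamic G S (dominating , co-dominating) outer inner =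
  joined G S outer inner , joined-proper G S outer inner , λ v _ →
    let u , vu , u∈S = dominating v
        w , vw , w∈∁S = co-dominating v
    in u , w , vu , vw , joined-inner-outer G S outer inner u∈S (x∈∁p⇒x∉p w∈∁S)

lemma3 : ∀ {n} (G : Graph n) →
    (((S : Subset n) → EulerBound (maxDeg G) (minDeg G) →
        IsTotalDominating G S → (∃[ v ] (v ∉ S)) →
        ∀ a b d → IsChromaticNumberOn G (∁ S) a → IsChromaticNumberOn G S b →
        IsDynamicChromaticNumber G d → d ≤ a + 2 * b)
    × ((S : Subset n) → IsDoubleTotalDominating G S →
        ∀ a b d → IsChromaticNumberOn G (∁ S) a → IsChromaticNumberOn G S b →
        IsDynamicChromaticNumber G d → d ≤ a + b))
lemma3 G =
  (λ S euler dominating outside a b d χ[∁S] χ[S] χd →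
     proj₂ χd (a + 2 * b) (total-dominating⇒dynamic G S euler dominating outside (proj₁ χ[∁S]) (proj₁ χ[S])))
  , (λ S double a b d χ[∁S] χ[S] χd →
     proj₂ χd (a + b) (double-total-dominating⇒dynamic G S double (proj₁ χ[∁S]) (proj₁ χ[S])))
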